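{- Let $G$ be a connected unicyclic graph that is not König–Egerváry. Consider any sequence of steps of the procedure below that produces $G$, and let $B$ be the set of black vertices of the resulting coloring. Then $B$ is a critical set of $G$. Procedure: (1) Construct an odd cycle and color its vertices blue. (2) Either perform step (3), or perform step (4), or stop. (3) Choose any existing vertex $u$, add two new vertices $u_1,u_2$ and edges $uu_1, u_1u_2$; color $u_1$ red and $u_2$ black; go to (2). (4) If there is a red vertex, choose a red vertex $u$, add a new vertex $u_1$ and the edge $uu_1$, color $u_1$ black; go to (2).
   Context: All graphs are finite and simple. $\alpha(G)$, $\mu(G)$ are independence and matching numbers; $G$ is König–Egerváry if $\alpha(G)+\mu(G)=|V(G)|$; unicyclic means having exactly one cycle. For $A\subseteq V(G)$, $N(A)$ is the set of vertices adjacent to some vertex of $A$, $d(A)=|A|-|N(A)|$, $d_c(G)=\max\{d(A):A\subseteq V(G)\}$, and $A$ is critical if $d(A)=d_c(G)$. Every connected unicyclic non-König–Egerváry graph is (isomorphic to a graph) produced by the procedure. -}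

module Defs where

open import Data.Nat using (ℕ; zero; suc; _+_; _*_; _%_; _≤_)
open import Data.Nat.Properties using () renaming (_≟_ to _≟ℕ_)
open import Data.Fin using (Fin; zero; suc; toℕ; inject₁; fromℕ)
open import Data.Fin.Properties using () renaming (_≟_ to _≟F_)
open import Data.Fin.Subset using (Subset; ∣_∣)
open import Data.Bool using (Bool; true; false; _∧_; _∨_)
open import Data.Vec using (lookup; tabulate)
open import Data.List using (List; length)
open import Data.List.Relation.Unary.All using (All)
open import Data.List.Relation.Unary.AllPairs using (AllPairs)
open import Data.Integer using (ℤ; +_; _-_) renaming (_≤_ to _≤ℤ_)
open import Data.Product using (Σ; _×_; _,_; ∃)
open import Data.Sum using (_⊎_)
open import Relation.Nullary using (¬_; ⌊_⌋)
open import Relation.Binary.PropositionalEquality using (_≡_; _≢_)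
open import Function.Definitions using (Injective)

record Graph (n : ℕ) : Set where
  field
    adj    : Fin n → Fin n → Bool
    sym    : ∀ x y → adj x y ≡ adj y x
    irrefl : ∀ x → adj x x ≡ false
open Graph public

anyFin : ∀ {n} → (Fin n → Bool) → Bool
anyFin {zero}  f = false
anyFin {suc n} f = f zero ∨ anyFin (λ i → f (suc i))

N : ∀ {n} → Graph n → Subset n → Subset n
N G A = tabulate (λ v → anyFin (λ u → lookup A u ∧ adj G u v))

d : ∀ {n} → Graph n → Subset n → ℤ
d G A = + ∣ A ∣ - + ∣ N G A ∣

-- A is critical iff d(A) = d_c(G) = max { d(A') : A' ⊆ V(G) },
-- i.e. d(A) is at least d(A') for every A'.
Critical : ∀ {n} → Graph n → Subset n → Set
Critical G A = ∀ A′ → d G A′ ≤ℤ d G A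

Independent : ∀ {n} → Graph n → Subset n → Set
Independent G S = ∀ u v → lookup S u ≡ true → lookup S v ≡ true → adj G u v ≡ false

IsIndependenceNumber : ∀ {n} → Graph n → ℕ → Set
IsIndependenceNumber G a =
  (Σ _ λ S → Independent G S × ∣ S ∣ ≡ a) × (∀ S → Independent G S → ∣ S ∣ ≤ a)

IsEdge : ∀ {n} → Graph n → Fin n × Fin n → Set
IsEdge G (x , y) = adj G x y ≡ true

DisjointEdges : ∀ {n} → Fin n × Fin n → Fin n × Fin n → Set
DisjointEdges (a , b) (c , e) = a ≢ c × a ≢ e × b ≢ c × b ≢ e

Matching : ∀ {n} → Graph n → List (Fin n × Fin n) → Set
Matching G M = All (IsEdge G) M × AllPairs DisjointEdges M

IsMatchingNumber : ∀ {n} → Graph n → ℕ → Set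
IsMatchingNumber G m =
  (Σ _ λ M → Matching G M × length M ≡ m) × (∀ M → Matching G M → length M ≤ m)

KonigEgervary : ∀ {n} → Graph n → Set
KonigEgervary {n} G = ∀ a m → IsIndependenceNumber G a → IsMatchingNumber G m → a + m ≡ n

data Walk {n} (G : Graph n) : Fin n → Fin n → Set where
  here : ∀ {x} → Walk G x x
  step : ∀ {x y z} → adj G x y ≡ true → Walk G y z → Walk G x z

Connected : ∀ {n} → Graph n → Set
Connected G = ∀ x y → Walk G x y

record Cycle {n} (G : Graph n) : Set where
  field
    k     : ℕ
    vs    : Fin (3 + k) → Fin n
    inj   : Injective _≡_ _≡_ vs
    steps : ∀ (i : Fin (2 + k)) → adj G (vs (inject₁ i)) (vs (suc i)) ≡ true
    close : adj G (vs (fromℕ (2 + k))) (vs zero) ≡ true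

CycleArc : ∀ {n} {G : Graph n} → Cycle G → Fin n → Fin n → Set
CycleArc C x y =
  (Σ (Fin (2 + Cycle.k C)) λ i → Cycle.vs C (inject₁ i) ≡ x × Cycle.vs C (suc i) ≡ y)
  ⊎ (Cycle.vs C (fromℕ (2 + Cycle.k C)) ≡ x × Cycle.vs C zero ≡ y)

CycleEdge : ∀ {n} {G : Graph n} → Cycle G → Fin n → Fin n → Set
CycleEdge C x y = CycleArc C x y ⊎ CycleArc C y x

SameCycle : ∀ {n} {G : Graph n} → Cycle G → Cycle G → Set
SameCycle C D = ∀ x y → (CycleEdge C x y → CycleEdge D x y) × (CycleEdge D x y → CycleEdge C x y)

Unicyclic : ∀ {n} → Graph n → Set
Unicyclic G = Σ (Cycle G) λ C → ∀ D → SameCycle C D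

-- New vertices are added at the front (index 0, 1),
-- old vertex x becomes suc x (resp. suc (suc x)).

data Colour : Set where
  blue red black : Colour

ext3 : ∀ {n} → (Fin n → Colour) → Fin (suc (suc n)) → Colour
ext3 c zero          = red
ext3 c (suc zero)    = black
ext3 c (suc (suc x)) = c x

ext4 : ∀ {n} → (Fin n → Colour) → Fin (suc n) → Colour
ext4 c zero    = black
ext4 c (suc x) = c x

data Proc : (n : ℕ) → (Fin n → Colour) → Set where
  cyc   : (k : ℕ) → Proc (3 + 2 * k) (λ _ → blue)
  step3 : ∀ {n c} → Proc n c → (u : Fin n) → Proc (suc (suc n)) (ext3 c)
  step4 : ∀ {n c} → Proc n c → (u : Fin n) → c u ≡ red → Proc (suc n) (ext4 c)

cycAdj : (m : ℕ) → Fin (suc m) → Fin (suc m) → Bool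
cycAdj m i j = ⌊ toℕ j ≟ℕ (suc (toℕ i) % suc m) ⌋ ∨ ⌊ toℕ i ≟ℕ (suc (toℕ j) % suc m) ⌋

procAdj : ∀ {n c} → Proc n c → Fin n → Fin n → Bool
procAdj (cyc k) i j = cycAdj (2 + 2 * k) i j
procAdj (step3 p u) zero          zero          = false
procAdj (step3 p u) zero          (suc zero)    = true
procAdj (step3 p u) zero          (suc (suc y)) = ⌊ y ≟F u ⌋
procAdj (step3 p u) (suc zero)    zero          = true
procAdj (step3 p u) (suc zero)    (suc zero)    = false
procAdj (step3 p u) (suc zero)    (suc (suc y)) = false
procAdj (step3 p u) (suc (suc x)) zero          = ⌊ x ≟F u ⌋
procAdj (step3 p u) (suc (suc x)) (suc zero)    = false
procAdj (step3 p u) (suc (suc x)) (suc (suc y)) = procAdj p x y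
procAdj (step4 p u r) zero    zero    = false
procAdj (step4 p u r) zero    (suc y) = ⌊ y ≟F u ⌋
procAdj (step4 p u r) (suc x) zero    = ⌊ x ≟F u ⌋
procAdj (step4 p u r) (suc x) (suc y) = procAdj p x y

isBlack : Colour → Bool
isBlack black = true
isBlack _     = false

-- Let s be the number of step-(4) vertices of the run.  Every other vertex
-- can be charged to a distinct neighbour (its successor on the odd cycle, or
-- its partner on the pendant edge u₁u₂ of step (3)), so d(A) ≤ s for every A.
-- Conversely every neighbour of a black vertex is red, and there are exactly s
-- more black than red vertices, so d(B) ≥ s for the black set B.  Neither
-- bound uses connectedness, unicyclicity or the failure of the König–Egerváry
-- property.
module Submission where

open import Defs
open import Data.Nat using (ℕ; zero; suc; _+_; _%_; _≤_; s≤s)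
open import Data.Nat.Properties
  using (_≟_; ≤-refl; ≤-trans; n≤1+n; +-comm; +-suc; +-identityʳ; m≤m+n; m+n∸m≡n; +-monoˡ-≤;
         +-0-commutativeMonoid; module ≤-Reasoning)
open import Data.Nat.DivMod using (n%n≡0; m<n⇒m%n≡m)
open import Data.Fin using (Fin; zero; suc; toℕ; inject₁; fromℕ)
open import Data.Fin.Properties using (toℕ-inject₁; toℕ-fromℕ; toℕ<n) renaming (_≟_ to _≟ᶠ_)
open import Data.Fin.Subset using (Subset; inside; outside; _∈_; _⊆_; ∣_∣)
open import Data.Fin.Subset.Properties using (p⊆q⇒∣p∣≤∣q∣; ∣p∣≤∣x∷p∣; ⊆-antisym; drop-there)
open import Data.Bool using (Bool; true; false; _∧_; if_then_else_)
open import Data.Vec using (_∷_; lookup; tabulate; tail; here; there)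
open import Data.Vec.Properties using (lookup∘tabulate; tabulate∘lookup; tabulate-cong; []=⇒lookup; lookup⇒[]=)
open import Data.Vec.Functional using (init; last)
open import Data.Integer using (ℤ; +_; _-_; _⊖_) renaming (_≤_ to _≤ℤ_)
import Data.Integer.Properties as ℤ
open import Data.Product using (∃-syntax; _×_; _,_)
open import Relation.Nullary using (¬_; yes)
open import Relation.Nullary.Decidable using (dec-true; isYes≗does)
open import Relation.Binary.PropositionalEquality as ≡ using (_≡_; refl; cong; cong₂; module ≡-Reasoning)
open import Function using (_∘_)
open import Function.Bundles using (_↔_; Inverse)
import Algebra.Properties.CommutativeMonoid.Sum as Sum

open Sum +-0-commutativeMonoid using (sum; sum-permute; sum-init-last)
open Inverse using (to; from; strictlyInverseˡ; strictlyInverseʳ)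

private
  variable
    n : ℕ

𝟙 : Bool → ℕ
𝟙 b = if b then 1 else 0

∣tabulate∣≡sum : (f : Fin n → Bool) → ∣ tabulate f ∣ ≡ sum (𝟙 ∘ f)
∣tabulate∣≡sum {zero}  f = refl
∣tabulate∣≡sum {suc n} f with f zero
... | true  = cong suc (∣tabulate∣≡sum (f ∘ suc))
... | false = ∣tabulate∣≡sum (f ∘ suc)

∣p∣≡sum : (p : Subset n) → ∣ p ∣ ≡ sum (𝟙 ∘ lookup p)
∣p∣≡sum p = ≡.trans (cong ∣_∣ (≡.sym (tabulate∘lookup p))) (∣tabulate∣≡sum (lookup p))

∣x∷p∣≤1+∣p∣ : ∀ x (p : Subset n) → ∣ x ∷ p ∣ ≤ suc ∣ p ∣
∣x∷p∣≤1+∣p∣ inside  p = ≤-refl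
∣x∷p∣≤1+∣p∣ outside p = n≤1+n ∣ p ∣

∣x∷y∷p∣≡∣y∷x∷p∣ : ∀ x y (p : Subset n) → ∣ x ∷ y ∷ p ∣ ≡ ∣ y ∷ x ∷ p ∣
∣x∷y∷p∣≡∣y∷x∷p∣ inside  inside  p = refl
∣x∷y∷p∣≡∣y∷x∷p∣ inside  outside p = refl
∣x∷y∷p∣≡∣y∷x∷p∣ outside inside  p = refl
∣x∷y∷p∣≡∣y∷x∷p∣ outside outside p = refl

∣∷∣-mono : ∀ {x y} {p q : Subset n} {t} → (zero ∈ x ∷ p → zero ∈ y ∷ q) →
           ∣ p ∣ ≤ ∣ q ∣ + t → ∣ x ∷ p ∣ ≤ ∣ y ∷ q ∣ + t
∣∷∣-mono {x = outside} {y} {q = q} {t} _ p≤q+t = ≤-trans p≤q+t (+-monoˡ-≤ t (∣p∣≤∣x∷p∣ y q))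
∣∷∣-mono {x = inside} head⇒ p≤q+t with head⇒ here
... | here = s≤s p≤q+t

∈-tabulate⁺ : ∀ {f : Fin n → Bool} {x} → f x ≡ true → x ∈ tabulate f
∈-tabulate⁺ {f = f} {x} fx = lookup⇒[]= x (tabulate f) (≡.trans (lookup∘tabulate f x) fx)

∈-tabulate⁻ : ∀ {f : Fin n → Bool} {x} → x ∈ tabulate f → f x ≡ true
∈-tabulate⁻ {f = f} {x} x∈ = ≡.trans (≡.sym (lookup∘tabulate f x)) ([]=⇒lookup x∈)

preimage : (Fin n → Fin n) → Subset n → Subset n
preimage π A = tabulate (lookup A ∘ π)

∈-preimage⁺ : ∀ {π : Fin n → Fin n} {A x} → π x ∈ A → x ∈ preimage π A
∈-preimage⁺ = ∈-tabulate⁺ ∘ []=⇒lookup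

∈-preimage⁻ : ∀ {π : Fin n → Fin n} {A x} → x ∈ preimage π A → π x ∈ A
∈-preimage⁻ {π = π} {A} {x} = lookup⇒[]= (π x) A ∘ ∈-tabulate⁻

preimage-tabulate : (π : Fin n → Fin n) (f : Fin n → Bool) → preimage π (tabulate f) ≡ tabulate (f ∘ π)
preimage-tabulate π f = tabulate-cong (lookup∘tabulate f ∘ π)

preimage-inverse : (σ : Fin n ↔ Fin n) (A : Subset n) → preimage (to σ) (preimage (from σ) A) ≡ A
preimage-inverse σ A = begin
  preimage (to σ) (tabulate (lookup A ∘ from σ)) ≡⟨ preimage-tabulate (to σ) _ ⟩
  tabulate (lookup A ∘ from σ ∘ to σ)            ≡⟨ tabulate-cong (cong (lookup A) ∘ strictlyInverseʳ σ) ⟩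
  tabulate (lookup A)                            ≡⟨ tabulate∘lookup A ⟩
  A                                              ∎
  where open ≡-Reasoning

∣preimage∣ : (σ : Fin n ↔ Fin n) (A : Subset n) → ∣ preimage (to σ) A ∣ ≡ ∣ A ∣
∣preimage∣ σ A = begin
  ∣ tabulate (lookup A ∘ to σ) ∣ ≡⟨ ∣tabulate∣≡sum (lookup A ∘ to σ) ⟩
  sum (𝟙 ∘ lookup A ∘ to σ)      ≡⟨ sum-permute (𝟙 ∘ lookup A) σ ⟨
  sum (𝟙 ∘ lookup A)             ≡⟨ ∣p∣≡sum A ⟨
  ∣ A ∣                          ∎
  where open ≡-Reasoning

-- N and d of Defs, for adjacencies not packaged as a Graph (procAdj is never
-- shown symmetric); N G and d G are definitionally Nbr (adj G) and deficiency (adj G).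
Adjacency : ℕ → Set
Adjacency n = Fin n → Fin n → Bool

Nbr : Adjacency n → Subset n → Subset n
Nbr a A = tabulate (λ v → anyFin (λ u → lookup A u ∧ a u v))

deficiency : Adjacency n → Subset n → ℤ
deficiency a A = + ∣ A ∣ - + ∣ Nbr a A ∣

anyFin⁺ : (f : Fin n → Bool) (x : Fin n) → f x ≡ true → anyFin f ≡ true
anyFin⁺ f zero    fx rewrite fx = refl
anyFin⁺ f (suc x) fx with f zero
... | true  = refl
... | false = anyFin⁺ (f ∘ suc) x fx

anyFin⁻ : (f : Fin n → Bool) → anyFin f ≡ true → ∃[ x ] f x ≡ true
anyFin⁻ {suc n} f any with f zero in f₀
... | true  = zero , f₀
... | false with anyFin⁻ (f ∘ suc) any
...   | x , fx = suc x , fx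

∈-Nbr⁺ : ∀ {a : Adjacency n} {A u v} → u ∈ A → a u v ≡ true → v ∈ Nbr a A
∈-Nbr⁺ {u = u} u∈A auv = ∈-tabulate⁺ (anyFin⁺ _ u (cong₂ _∧_ ([]=⇒lookup u∈A) auv))

∈-Nbr⁻ : ∀ {a : Adjacency n} {A v} → v ∈ Nbr a A → ∃[ u ] u ∈ A × a u v ≡ true
∈-Nbr⁻ {a = a} {A} {v} v∈N with anyFin⁻ _ (∈-tabulate⁻ v∈N)
... | u , uv with lookup A u in A[u] | a u v in auv
...   | true | true = u , lookup⇒[]= u A A[u] , auv

module _ {a a′ : Adjacency n} (σ : Fin n ↔ Fin n)
         (iso : ∀ x y → a′ x y ≡ a (to σ x) (to σ y)) where

  Nbr-preimage : (A : Subset n) → Nbr a′ (preimage (to σ) A) ≡ preimage (to σ) (Nbr a A)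
  Nbr-preimage A = ⊆-antisym forward backward
    where
    forward : Nbr a′ (preimage (to σ) A) ⊆ preimage (to σ) (Nbr a A)
    forward {v} v∈ with ∈-Nbr⁻ {a = a′} {preimage (to σ) A} v∈
    ... | u , u∈ , a′uv =
      ∈-preimage⁺ (∈-Nbr⁺ {a = a} (∈-preimage⁻ {π = to σ} {A} u∈) (≡.trans (≡.sym (iso u v)) a′uv))

    backward : preimage (to σ) (Nbr a A) ⊆ Nbr a′ (preimage (to σ) A)
    backward {v} v∈ with ∈-Nbr⁻ {a = a} {A} (∈-preimage⁻ {A = Nbr a A} v∈)
    ... | w , w∈A , awv = ∈-Nbr⁺ {a = a′} (∈-preimage⁺ {π = to σ} {A} (≡.subst (_∈ A) w≡σσ⁻¹w w∈A))
      (≡.trans (iso (from σ w) v) (≡.subst (λ z → a z (to σ v) ≡ true) w≡σσ⁻¹w awv))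
      where w≡σσ⁻¹w = ≡.sym (strictlyInverseˡ σ w)

  deficiency-preimage : (A : Subset n) → deficiency a′ (preimage (to σ) A) ≡ deficiency a A
  deficiency-preimage A = cong₂ (λ x y → + x - + y) (∣preimage∣ σ A)
    (≡.trans (cong ∣_∣ (Nbr-preimage A)) (∣preimage∣ σ (Nbr a A)))

[m+n]⊖m≡n : ∀ m n → (m + n) ⊖ m ≡ + n
[m+n]⊖m≡n m n = ≡.trans (ℤ.⊖-≥ (m≤m+n m n)) (cong +_ (m+n∸m≡n m n))

+m-+n≤+o : ∀ m n o → m ≤ n + o → + m - + n ≤ℤ + o
+m-+n≤+o m n o m≤n+o = begin
  + m - + n     ≡⟨ ℤ.[+m]-[+n]≡m⊖n m n ⟩
  m ⊖ n         ≤⟨ ℤ.⊖-monoˡ-≤ n m≤n+o ⟩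
  (n + o) ⊖ n   ≡⟨ [m+n]⊖m≡n n o ⟩
  + o           ∎
  where open ℤ.≤-Reasoning

+o≤+m-+n : ∀ m n o → n + o ≤ m → + o ≤ℤ + m - + n
+o≤+m-+n m n o n+o≤m = begin
  + o           ≡⟨ [m+n]⊖m≡n n o ⟨
  (n + o) ⊖ n   ≤⟨ ℤ.⊖-monoˡ-≤ n n+o≤m ⟩
  m ⊖ n         ≡⟨ ℤ.[+m]-[+n]≡m⊖n m n ⟨
  + m - + n     ∎
  where open ℤ.≤-Reasoning

preimage⊆Nbr : ∀ {a : Adjacency n} {ρ : Fin n → Fin n} A → (∀ v → a (ρ v) v ≡ true) → preimage ρ A ⊆ Nbr a A
preimage⊆Nbr {a = a} {ρ} A ρ-adj {v} v∈ = ∈-Nbr⁺ {a = a} (∈-preimage⁻ {π = ρ} {A} v∈) (ρ-adj v)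

prev : ∀ {m} → Fin (suc m) → Fin (suc m)
prev zero    = fromℕ _
prev (suc i) = inject₁ i

suc-prev : ∀ m (v : Fin (suc m)) → suc (toℕ (prev v)) % suc m ≡ toℕ v
suc-prev m zero = begin
  suc (toℕ (fromℕ m)) % suc m ≡⟨ cong (λ k → suc k % suc m) (toℕ-fromℕ m) ⟩
  suc m % suc m               ≡⟨ n%n≡0 (suc m) ⟩
  0                           ∎
  where open ≡-Reasoning
suc-prev (suc m) (suc i) = begin
  suc (toℕ (inject₁ i)) % suc (suc m) ≡⟨ cong (λ k → suc k % suc (suc m)) (toℕ-inject₁ i) ⟩
  suc (toℕ i) % suc (suc m)           ≡⟨ m<n⇒m%n≡m (s≤s (toℕ<n i)) ⟩
  suc (toℕ i)                         ∎
  where open ≡-Reasoning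

cycAdj-prev : ∀ m v → cycAdj m (prev v) v ≡ true
cycAdj-prev m v rewrite ≡.trans (isYes≗does (toℕ v ≟ _)) (dec-true (toℕ v ≟ _) (≡.sym (suc-prev m v))) = refl

∣preimage-prev∣ : ∀ {m} (A : Subset (suc m)) → ∣ preimage prev A ∣ ≡ ∣ A ∣
∣preimage-prev∣ A = begin
  ∣ tabulate (lookup A ∘ prev) ∣ ≡⟨ ∣tabulate∣≡sum (lookup A ∘ prev) ⟩
  last f + sum (init f)          ≡⟨ +-comm (last f) _ ⟩
  sum (init f) + last f          ≡⟨ sum-init-last f ⟨
  sum f                          ≡⟨ ∣p∣≡sum A ⟨
  ∣ A ∣                          ∎
  where open ≡-Reasoning
        f = 𝟙 ∘ lookup A

cycle-∣A∣≤∣Nbr∣ : ∀ m (A : Subset (suc m)) → ∣ A ∣ ≤ ∣ Nbr (cycAdj m) A ∣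
cycle-∣A∣≤∣Nbr∣ m A = begin
  ∣ A ∣              ≡⟨ ∣preimage-prev∣ A ⟨
  ∣ preimage prev A ∣ ≤⟨ p⊆q⇒∣p∣≤∣q∣ (preimage⊆Nbr {a = cycAdj m} {prev} A (cycAdj-prev m)) ⟩
  ∣ Nbr (cycAdj m) A ∣ ∎
  where open ≤-Reasoning

steps4 : ∀ {c} → Proc n c → ℕ
steps4 (cyc k)       = 0
steps4 (step3 p u)   = steps4 p
steps4 (step4 p u r) = suc (steps4 p)

∈-Nbr-∷ : ∀ {a′ : Adjacency (suc n)} {a : Adjacency n} {v} x A →
        (∀ u w → a′ (suc u) (suc w) ≡ a u w) → v ∈ Nbr a A → suc v ∈ Nbr a′ (x ∷ A)
∈-Nbr-∷ {a′ = a′} {a} x A restrict v∈ with ∈-Nbr⁻ {a = a} {A} v∈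
... | u , u∈A , auv = ∈-Nbr⁺ {a = a′} (there u∈A) (≡.trans (restrict u _) auv)

∣A∣≤∣Nbr∣+steps4 : ∀ {c} (p : Proc n c) A → ∣ A ∣ ≤ ∣ Nbr (procAdj p) A ∣ + steps4 p
∣A∣≤∣Nbr∣+steps4 (cyc k) A = ≤-trans (cycle-∣A∣≤∣Nbr∣ _ A) (m≤m+n _ 0)
∣A∣≤∣Nbr∣+steps4 (step3 p u) (x₀ ∷ x₁ ∷ A) = begin
  ∣ x₀ ∷ x₁ ∷ A ∣ ≡⟨ ∣x∷y∷p∣≡∣y∷x∷p∣ x₀ x₁ A ⟩
  ∣ x₁ ∷ x₀ ∷ A ∣ ≤⟨ ∣∷∣-mono u₂∈⇒u₁∈N (∣∷∣-mono u₁∈⇒u₂∈N old-bound) ⟩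
  ∣ N′ ∣ + s      ∎
  where
  open ≤-Reasoning
  a′ = procAdj (step3 p u)
  s  = steps4 p
  N′ = Nbr a′ (x₀ ∷ x₁ ∷ A)

  u₂∈⇒u₁∈N : zero ∈ x₁ ∷ x₀ ∷ A → zero ∈ N′
  u₂∈⇒u₁∈N here = ∈-Nbr⁺ {a = a′} {x₀ ∷ x₁ ∷ A} (there here) refl

  u₁∈⇒u₂∈N : zero ∈ x₀ ∷ A → zero ∈ tail N′
  u₁∈⇒u₂∈N here = drop-there (∈-Nbr⁺ {a = a′} {x₀ ∷ x₁ ∷ A} here refl)

  Nbr⊆tail² : Nbr (procAdj p) A ⊆ tail (tail N′)
  Nbr⊆tail² = drop-there ∘ drop-there ∘ ∈-Nbr-∷ {a′ = a′} x₀ (x₁ ∷ A) (λ _ _ → refl)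
                                     ∘ ∈-Nbr-∷ {a′ = λ v w → a′ (suc v) (suc w)} x₁ A (λ _ _ → refl)

  old-bound : ∣ A ∣ ≤ ∣ tail (tail N′) ∣ + s
  old-bound = ≤-trans (∣A∣≤∣Nbr∣+steps4 p A) (+-monoˡ-≤ s (p⊆q⇒∣p∣≤∣q∣ Nbr⊆tail²))
∣A∣≤∣Nbr∣+steps4 (step4 p u r) (x ∷ A) = begin
  ∣ x ∷ A ∣                   ≤⟨ ∣x∷p∣≤1+∣p∣ x A ⟩
  suc ∣ A ∣                   ≤⟨ s≤s (∣A∣≤∣Nbr∣+steps4 p A) ⟩
  suc (∣ Nbr a A ∣ + s)       ≤⟨ s≤s (+-monoˡ-≤ s (p⊆q⇒∣p∣≤∣q∣ Nbr⊆tail)) ⟩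
  suc (∣ tail N′ ∣ + s)       ≡⟨ +-suc _ s ⟨
  ∣ tail N′ ∣ + suc s         ≤⟨ +-monoˡ-≤ (suc s) (∣p∣≤∣x∷p∣ (lookup N′ zero) (tail N′)) ⟩
  ∣ N′ ∣ + suc s              ∎
  where
  open ≤-Reasoning
  a = procAdj p
  s = steps4 p
  N′ = Nbr (procAdj (step4 p u r)) (x ∷ A)
  Nbr⊆tail : Nbr a A ⊆ tail N′
  Nbr⊆tail = drop-there ∘ ∈-Nbr-∷ {a′ = procAdj (step4 p u r)} {a} x A (λ _ _ → refl)

isRed : Colour → Bool
isRed red = true
isRed _   = false

Black Red : (Fin n → Colour) → Subset n
Black c = tabulate (isBlack ∘ c)
Red   c = tabulate (isRed ∘ c)

isBlack⁻ : ∀ {κ} → isBlack κ ≡ true → κ ≡ black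
isBlack⁻ {black} _ = refl

black-neighbour-red : ∀ {c} (p : Proc n c) {u v} → c u ≡ black → procAdj p u v ≡ true → c v ≡ red
black-neighbour-red (cyc k) ()
black-neighbour-red (step3 p w) {zero}        ()
black-neighbour-red (step3 p w) {suc zero}    {zero}        _ _  = refl
black-neighbour-red (step3 p w) {suc zero}    {suc zero}    _ ()
black-neighbour-red (step3 p w) {suc zero}    {suc (suc y)} _ ()
black-neighbour-red (step3 p w) {suc (suc x)} {zero}        _ _  = refl
black-neighbour-red (step3 p w) {suc (suc x)} {suc zero}    _ ()
black-neighbour-red (step3 p w) {suc (suc x)} {suc (suc y)} cu e = black-neighbour-red p cu e
black-neighbour-red (step4 p w cw) {zero}  {suc y} _ e with y ≟ᶠ w
... | yes refl = cw
black-neighbour-red (step4 p w cw) {suc x} {zero}  cx e with x ≟ᶠ w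
... | yes refl with () ← ≡.trans (≡.sym cx) cw
black-neighbour-red (step4 p w cw) {suc x} {suc y} cx e = black-neighbour-red p cx e

Nbr-Black⊆Red : ∀ {c} (p : Proc n c) → Nbr (procAdj p) (Black c) ⊆ Red c
Nbr-Black⊆Red {c = c} p v∈ with ∈-Nbr⁻ {a = procAdj p} {Black c} v∈
... | u , u∈B , e = ∈-tabulate⁺ (cong isRed (black-neighbour-red p (isBlack⁻ (∈-tabulate⁻ u∈B)) e))

∣Black∣≡∣Red∣+steps4 : ∀ {c} (p : Proc n c) → ∣ Black c ∣ ≡ ∣ Red c ∣ + steps4 p
∣Black∣≡∣Red∣+steps4 (cyc k)       = ≡.sym (+-identityʳ _)
∣Black∣≡∣Red∣+steps4 (step3 p u)   = cong suc (∣Black∣≡∣Red∣+steps4 p)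
∣Black∣≡∣Red∣+steps4 (step4 p u r) = ≡.trans (cong suc (∣Black∣≡∣Red∣+steps4 p)) (≡.sym (+-suc _ _))

∣Nbr-Black∣+steps4≤∣Black∣ : ∀ {c} (p : Proc n c) →
  ∣ Nbr (procAdj p) (Black c) ∣ + steps4 p ≤ ∣ Black c ∣
∣Nbr-Black∣+steps4≤∣Black∣ {c = c} p = begin
  ∣ Nbr (procAdj p) (Black c) ∣ + steps4 p ≤⟨ +-monoˡ-≤ (steps4 p) (p⊆q⇒∣p∣≤∣q∣ (Nbr-Black⊆Red p)) ⟩
  ∣ Red c ∣ + steps4 p                    ≡⟨ ∣Black∣≡∣Red∣+steps4 p ⟨
  ∣ Black c ∣                             ∎
  where open ≤-Reasoning

theorem4p14 : ∀ {n} (G : Graph n) → Connected G → Unicyclic G → ¬ KonigEgervary G →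
    ∀ {c : Fin n → Colour} (p : Proc n c) (φ : Fin n ↔ Fin n) →
    (∀ x y → adj G x y ≡ procAdj p (Inverse.to φ x) (Inverse.to φ y)) →
    Critical G (tabulate (λ x → isBlack (c (Inverse.to φ x))))
theorem4p14 G _ _ _ {c} p φ G≅p A = begin
  d G A                            ≡⟨ cong (d G) (preimage-inverse φ A) ⟨
  d G (preimage (to φ) A₀)         ≡⟨ relabel A₀ ⟩
  deficiency (procAdj p) A₀        ≤⟨ +m-+n≤+o _ _ (steps4 p) (∣A∣≤∣Nbr∣+steps4 p A₀) ⟩
  + steps4 p                       ≤⟨ +o≤+m-+n _ _ (steps4 p) (∣Nbr-Black∣+steps4≤∣Black∣ p) ⟩
  deficiency (procAdj p) (Black c) ≡⟨ relabel (Black c) ⟨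
  d G (preimage (to φ) (Black c))  ≡⟨ cong (d G) (preimage-tabulate (to φ) (isBlack ∘ c)) ⟩
  d G (Black (c ∘ to φ))           ∎
  where
  open ℤ.≤-Reasoning
  A₀ = preimage (from φ) A
  relabel = deficiency-preimage {a = procAdj p} {adj G} φ G≅p
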